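{- Fix positive integers $k<n$. Given a cylindric partition $\alpha$ on $\mathcal{C}_{k,n}$ and a nonnegative integer $t$, the number of marble games with $t$ turns that start with the arrangement $\operatorname{Arr}(\alpha)$ equals the number of marble games with $t$ turns that end with the arrangement $\operatorname{Arr}(\alpha)$, and this also equals the number of marble games with $t$ turns that start with $\operatorname{Arr}(\alpha)$ but in which marbles are passed counterclockwise (from $p_i$ to $p_{i-1}$) instead of clockwise. The same equalities hold if one counts only games in which exactly one marble changes hands on every turn.
   Context: A cylindric partition on $\mathcal{C}_{k,n}=\mathbb{Z}^2/(-k,n-k)\mathbb{Z}$ is a weakly decreasing bi-infinite integer sequence $(\alpha_i)_{i\in\mathbb{Z}}$ with $\alpha_i=\alpha_{i+k}+n-k$. Marble game: $k$ people $p_0,\dots,p_{k-1}$ sit in a circle, indices mod $k$, with $p_i$ clockwise from $p_{i-1}$. $\operatorname{Arr}(\alpha)$ is the arrangement in which $p_i$ has $\alpha_{i-1}-\alpha_i$ marbles (total $n-k$). A turn is a tuple $(a_0,\dots,a_{k-1})$ of nonnegative integers in which, simultaneously, each $p_i$ passes $a_i$ marbles to $p_{i+1}$, with $a_i$ at most the number of marbles $p_i$ currently has. A marble game of length $t$ is an initial arrangement of the $n-k$ marbles together with $t$ successive turns; it ends with the arrangement obtained after the $t$-th turn. -}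

module Defs where

open import Data.Nat as ℕ using (ℕ; zero; suc; _∸_; NonZero)
open import Data.Nat.DivMod using (_mod_)
open import Data.Integer as ℤ using (ℤ; +_; ∣_∣)
open import Data.Fin using (Fin; toℕ)
open import Data.Vec using (Vec; []; _∷_; lookup; tabulate; sum)
open import Data.Vec.Relation.Binary.Pointwise.Inductive using (Pointwise)
open import Data.Product using (Σ; _×_)
open import Data.Unit using (⊤)
open import Data.Bool using (Bool; true; false)
open import Relation.Binary.PropositionalEquality using (_≡_)

record CylindricPartition (k n : ℕ) : Set where
  field
    α        : ℤ → ℤ
    weakDec  : ∀ i j → i ℤ.≤ j → α j ℤ.≤ α i
    periodic : ∀ i → α i ≡ α (i ℤ.+ + k) ℤ.+ + (n ∸ k)
open CylindricPartition public

-- Arrangements / turns: p_i's entry is the i-th coordinate (i : Fin k).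
Arrangement : ℕ → Set
Arrangement k = Vec ℕ k

Turn : ℕ → Set
Turn k = Vec ℕ k

module _ (k : ℕ) .{{_ : NonZero k}} where

  prevIdx : Fin k → Fin k
  prevIdx i = (toℕ i ℕ.+ (k ∸ 1)) mod k

  nextIdx : Fin k → Fin k
  nextIdx i = (suc (toℕ i)) mod k

-- Arr(α): p_i has α_{i-1} - α_i marbles (nonnegative since α is weakly decreasing)
Arr : ∀ {k n} → CylindricPartition k n → Arrangement k
Arr {k} c = tabulate λ i →
  ∣ α c (+ toℕ i ℤ.- + 1) ℤ.- α c (+ toℕ i) ∣

data Direction : Set where
  clockwise counterclockwise : Direction

step : (k : ℕ) .{{_ : NonZero k}} → Direction → Arrangement k → Turn k → Arrangement k
step k clockwise m a =
  tabulate λ i → lookup m i ∸ lookup a i ℕ.+ lookup a (prevIdx k i)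
step k counterclockwise m a =
  tabulate λ i → lookup m i ∸ lookup a i ℕ.+ lookup a (nextIdx k i)

TurnOK : ∀ {k} → Bool → Turn k → Set
TurnOK false a = ⊤
TurnOK true  a = sum a ≡ 1

ValidTurns : (k : ℕ) .{{_ : NonZero k}} → Direction → Bool →
             Arrangement k → ∀ {t} → Vec (Turn k) t → Set
ValidTurns k d b m [] = ⊤
ValidTurns k d b m (a ∷ as) =
  Pointwise ℕ._≤_ a m × TurnOK b a × ValidTurns k d b (step k d m a) as

final : (k : ℕ) .{{_ : NonZero k}} → Direction → Arrangement k → ∀ {t} → Vec (Turn k) t → Arrangement k
final k d m [] = m
final k d m (a ∷ as) = final k d (step k d m a) as

GamesStartingAt : (k : ℕ) .{{_ : NonZero k}} → Direction → Bool → ℕ → Arrangement k → Set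
GamesStartingAt k d b t A = Σ (Vec (Turn k) t) λ ts → ValidTurns k d b A ts

GamesEndingAt : (k n : ℕ) .{{_ : NonZero k}} → Direction → Bool → ℕ → Arrangement k → Set
GamesEndingAt k n d b t A =
  Σ (Arrangement k) λ m₀ → sum m₀ ≡ n ∸ k ×
    Σ (Vec (Turn k) t) λ ts → ValidTurns k d b m₀ ts × final k d m₀ ts ≡ A

-- Reading a clockwise game backwards, each turn becomes the counterclockwise turn in
-- which every person returns what they have just received; so games ending at Arr α
-- correspond to counterclockwise games starting there, and it suffices to compare
-- clockwise and counterclockwise games from a fixed arrangement.  A clockwise turn
-- followed by a counterclockwise one can be traded, bijectively and with the same
-- outcome, for a counterclockwise turn followed by a clockwise one, and the admissible
-- turns from an arrangement do not depend on the direction.  Hence the number of games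
-- with a prescribed sequence of directions depends only on its length.  All these
-- bijections preserve the number of marbles passed in each turn, which gives the
-- one-marble version; the partition only enters through the n - k marbles of Arr α.

module Submission where

open import Defs

open import Axiom.UniquenessOfIdentityProofs using (module Decidable⇒UIP)
open import Data.Bool using (Bool; true; false)
open import Data.Fin as Fin using (Fin; toℕ)
open import Data.Fin.Permutation using (Permutation′; permutation; flip; _⟨$⟩ʳ_; _⟨$⟩ˡ_; inverseˡ; inverseʳ)
open import Data.Fin.Properties using (toℕ-injective; toℕ-fromℕ<; toℕ<n)
open import Data.Integer as ℤ using (ℤ; ∣_∣)
open import Data.Integer.Properties using (0≤i⇒+∣i∣≡i; i≤j⇒0≤j-i; i-j≤i; pos-+; +-inverseʳ; +-injective)
open import Data.Nat as ℕ using (ℕ; NonZero; _<_; zero; suc; _+_; _∸_; _⊓_; _≤_; _%_; _≟_; >-nonZero⁻¹)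
open import Data.Nat.DivMod using (%-distribˡ-+; m%n%n≡m%n; [m+n]%n≡m%n; m<n⇒m%n≡m)
open import Data.Nat.Properties
open import Data.Product using (Σ; _×_; _,_; proj₁; proj₂)
open import Data.Product.Function.Dependent.Propositional using (congˡ)
open import Data.Product.Function.NonDependent.Propositional using (_×-↔_)
open import Data.Sum using (inj₁; inj₂)
open import Data.Unit using (tt)
open import Data.Vec using (Vec; []; _∷_; lookup; tabulate; sum; replicate)
open import Data.Vec.Properties using (lookup∘tabulate; tabulate∘lookup; tabulate-cong; ≡-dec)
open import Data.Vec.Relation.Binary.Pointwise.Extensional using (ext; extensional⇒inductive)
open import Data.Vec.Relation.Binary.Pointwise.Inductive as Pointwise using (Pointwise; []; _∷_; tabulate⁺)
open import Function using (_∘_; _∘′_)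
open import Function.Bundles using (_↔_; mk↔ₛ′; Inverse)
open import Function.Properties.Inverse using (↔-refl; ↔-sym; ↔-trans)
open import Function.Related.TypeIsomorphisms using (×-comm)
open import Relation.Binary.PropositionalEquality
open ≡-Reasoning

open import Algebra.Properties.CommutativeMonoid.Sum +-0-commutativeMonoid
  using (∑-distrib-+; sum-permute; sum-cong-≗) renaming (sum to ∑)
import Data.Nat.Tactic.RingSolver as ℕ-Solver
import Data.Integer.Tactic.RingSolver as ℤ-Solver

m⊓n+m∸n≡m : ∀ m n → m ⊓ n + (m ∸ n) ≡ m
m⊓n+m∸n≡m m n = trans (cong (_+ (m ∸ n)) (⊓-comm m n)) (m⊓n+n∸m≡n n m)

[m∸n]∸[n∸m]≡m∸n : ∀ m n → (m ∸ n) ∸ (n ∸ m) ≡ m ∸ n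
[m∸n]∸[n∸m]≡m∸n m n with ≤-total n m
... | inj₁ n≤m = cong ((m ∸ n) ∸_) (m≤n⇒m∸n≡0 n≤m)
... | inj₂ m≤n = begin
  (m ∸ n) ∸ (n ∸ m) ≡⟨ cong (_∸ (n ∸ m)) (m≤n⇒m∸n≡0 m≤n) ⟩
  0 ∸ (n ∸ m)       ≡⟨ 0∸n≡0 (n ∸ m) ⟩
  0                 ≡⟨ m≤n⇒m∸n≡0 m≤n ⟨
  m ∸ n             ∎

[o+m∸n]⊓[o+n∸m]≡o : ∀ o m n → (o + (m ∸ n)) ⊓ (o + (n ∸ m)) ≡ o
[o+m∸n]⊓[o+n∸m]≡o o m n = begin
  (o + (m ∸ n)) ⊓ (o + (n ∸ m)) ≡⟨ +-distribˡ-⊓ o (m ∸ n) (n ∸ m) ⟨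
  o + ((m ∸ n) ⊓ (n ∸ m))       ≡⟨ cong (o +_) ([m∸n]⊓[n∸m]≡0 m n) ⟩
  o + 0                         ≡⟨ +-identityʳ o ⟩
  o                             ∎

[o+m∸n]∸[o+n∸m]≡m∸n : ∀ o m n → (o + (m ∸ n)) ∸ (o + (n ∸ m)) ≡ m ∸ n
[o+m∸n]∸[o+n∸m]≡m∸n o m n =
  trans ([m+n]∸[m+o]≡n∸o o (m ∸ n) (n ∸ m)) ([m∸n]∸[n∸m]≡m∸n m n)

m⊓n+[[o+m∸n]∸[o+n∸m]]≡m : ∀ o m n → m ⊓ n + ((o + (m ∸ n)) ∸ (o + (n ∸ m))) ≡ m
m⊓n+[[o+m∸n]∸[o+n∸m]]≡m o m n =
  trans (cong (m ⊓ n +_) ([o+m∸n]∸[o+n∸m]≡m∸n o m n)) (m⊓n+m∸n≡m m n)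

[m+n]∸o≡[m∸[o∸n]]+[n∸o] : ∀ m n o → m + n ∸ o ≡ m ∸ (o ∸ n) + (n ∸ o)
[m+n]∸o≡[m∸[o∸n]]+[n∸o] m n o with ≤-total n o
... | inj₁ n≤o = begin
  m + n ∸ o                 ≡⟨ cong₂ _∸_ (+-comm n m) (m+[n∸m]≡n n≤o) ⟨
  n + m ∸ (n + (o ∸ n))     ≡⟨ [m+n]∸[m+o]≡n∸o n m (o ∸ n) ⟩
  m ∸ (o ∸ n)               ≡⟨ +-identityʳ _ ⟨
  m ∸ (o ∸ n) + 0           ≡⟨ cong (m ∸ (o ∸ n) +_) (m≤n⇒m∸n≡0 n≤o) ⟨
  m ∸ (o ∸ n) + (n ∸ o)     ∎
... | inj₂ o≤n = begin
  m + n ∸ o                 ≡⟨ +-∸-assoc m o≤n ⟩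
  m + (n ∸ o)               ≡⟨ cong (λ z → m ∸ z + (n ∸ o)) (m≤n⇒m∸n≡0 o≤n) ⟨
  m ∸ (o ∸ n) + (n ∸ o)     ∎

-- One seat in the exchange below: it holds m, sends p and receives x in the forward
-- turn, then sends y and receives q in the backward turn; c is the next seat's ⊓-term.
module _ {m p q x y : ℕ} (p≤m : p ≤ m) (y≤m∸p+x : y ≤ m ∸ p + x) where

  private
    y∸x≤m∸p : y ∸ x ≤ m ∸ p
    y∸x≤m∸p = subst (y ∸ x ≤_) (m+n∸n≡m (m ∸ p) x) (∸-monoˡ-≤ x y≤m∸p+x)

    m∸[p⊓q+[y∸x]]≡m∸p∸[y∸x]+[p∸q] : m ∸ (p ⊓ q + (y ∸ x)) ≡ m ∸ p ∸ (y ∸ x) + (p ∸ q)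
    m∸[p⊓q+[y∸x]]≡m∸p∸[y∸x]+[p∸q] = begin
      m ∸ (p ⊓ q + (y ∸ x))               ≡⟨ ∸-+-assoc m (p ⊓ q) (y ∸ x) ⟨
      m ∸ p ⊓ q ∸ (y ∸ x)                 ≡⟨ cong (λ z → z ∸ p ⊓ q ∸ (y ∸ x)) (m∸n+n≡m p≤m) ⟨
      m ∸ p + p ∸ p ⊓ q ∸ (y ∸ x)         ≡⟨ cong (_∸ (y ∸ x)) (+-∸-assoc (m ∸ p) (m⊓n≤m p q)) ⟩
      m ∸ p + (p ∸ p ⊓ q) ∸ (y ∸ x)       ≡⟨ cong (λ z → m ∸ p + z ∸ (y ∸ x)) p∸p⊓q≡p∸q ⟩
      m ∸ p + (p ∸ q) ∸ (y ∸ x)           ≡⟨ +-∸-comm (p ∸ q) y∸x≤m∸p ⟩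
      m ∸ p ∸ (y ∸ x) + (p ∸ q)           ∎
      where
      p∸p⊓q≡p∸q : p ∸ p ⊓ q ≡ p ∸ q
      p∸p⊓q≡p∸q = trans (cong (_∸ p ⊓ q) (sym (m⊓n+m∸n≡m p q))) (m+n∸m≡n (p ⊓ q) (p ∸ q))

  exchange-seat-≤ˡ : p ⊓ q + (y ∸ x) ≤ m
  exchange-seat-≤ˡ = subst (p ⊓ q + (y ∸ x) ≤_) (m+[n∸m]≡n p≤m) (+-mono-≤ (m⊓n≤m p q) y∸x≤m∸p)

  exchange-seat-≤ʳ : ∀ c → c + (p ∸ q) ≤ m ∸ (p ⊓ q + (y ∸ x)) + (c + (q ∸ p))
  exchange-seat-≤ʳ c = subst (λ z → c + (p ∸ q) ≤ z + (c + (q ∸ p))) (sym m∸[p⊓q+[y∸x]]≡m∸p∸[y∸x]+[p∸q])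
    (subst (_≤ m ∸ p ∸ (y ∸ x) + (p ∸ q) + (c + (q ∸ p))) (+-comm (p ∸ q) c)
      (+-mono-≤ (m≤n+m (p ∸ q) (m ∸ p ∸ (y ∸ x))) (m≤m+n c (q ∸ p))))

  exchange-seat-≡ : ∀ c → m ∸ (p ⊓ q + (y ∸ x)) + (c + (q ∸ p)) ∸ (c + (p ∸ q)) + (p ⊓ q + (x ∸ y))
                        ≡ m ∸ p + x ∸ y + q
  exchange-seat-≡ c = begin
    m ∸ (p ⊓ q + (y ∸ x)) + (c + (q ∸ p)) ∸ (c + (p ∸ q)) + (p ⊓ q + (x ∸ y))
      ≡⟨ cong (λ z → z + (c + (q ∸ p)) ∸ (c + (p ∸ q)) + (p ⊓ q + (x ∸ y)))
              m∸[p⊓q+[y∸x]]≡m∸p∸[y∸x]+[p∸q] ⟩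
    r + (p ∸ q) + (c + (q ∸ p)) ∸ (c + (p ∸ q)) + (p ⊓ q + (x ∸ y))
      ≡⟨ cong (λ z → z ∸ (c + (p ∸ q)) + (p ⊓ q + (x ∸ y))) (interchange r (p ∸ q) c (q ∸ p)) ⟩
    r + (q ∸ p) + (c + (p ∸ q)) ∸ (c + (p ∸ q)) + (p ⊓ q + (x ∸ y))
      ≡⟨ cong (_+ (p ⊓ q + (x ∸ y))) (m+n∸n≡m (r + (q ∸ p)) (c + (p ∸ q))) ⟩
    r + (q ∸ p) + (p ⊓ q + (x ∸ y))
      ≡⟨ interchange r (q ∸ p) (p ⊓ q) (x ∸ y) ⟩
    r + (x ∸ y) + (p ⊓ q + (q ∸ p))
      ≡⟨ cong₂ _+_ ([m+n]∸o≡[m∸[o∸n]]+[n∸o] (m ∸ p) x y) (sym (m⊓n+n∸m≡n p q)) ⟨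
    m ∸ p + x ∸ y + q ∎
    where
    r : ℕ
    r = m ∸ p ∸ (y ∸ x)
    interchange : ∀ r s c t → r + s + (c + t) ≡ r + t + (c + s)
    interchange = ℕ-Solver.solve-∀

private
  variable
    k : ℕ

tabulate≡ : ∀ {n} {f : Fin n → ℕ} {v : Vec ℕ n} → (∀ j → f j ≡ lookup v j) → tabulate f ≡ v
tabulate≡ {v = v} f≗v = trans (tabulate-cong f≗v) (tabulate∘lookup v)

pointwise : ∀ {n} {u v : Vec ℕ n} → (∀ j → lookup u j ≤ lookup v j) → Pointwise _≤_ u v
pointwise u≤v = extensional⇒inductive (ext u≤v)

sum-tabulate : ∀ {n} (f : Fin n → ℕ) → sum (tabulate f) ≡ ∑ f
sum-tabulate {zero}  f = refl
sum-tabulate {suc n} f = cong (f Fin.zero +_) (sum-tabulate (f ∘ Fin.suc))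

sum≡∑-lookup : ∀ {n} (v : Vec ℕ n) → sum v ≡ ∑ (lookup v)
sum≡∑-lookup v = trans (cong sum (sym (tabulate∘lookup v))) (sum-tabulate (lookup v))

∑-permute-+ˡ : ∀ {n} (τ : Permutation′ n) (f g : Fin n → ℕ) →
               ∑ (λ j → f (τ ⟨$⟩ʳ j) + g j) ≡ ∑ (λ j → f j + g j)
∑-permute-+ˡ τ f g = begin
  ∑ (λ j → f (τ ⟨$⟩ʳ j) + g j)   ≡⟨ ∑-distrib-+ (f ∘ (τ ⟨$⟩ʳ_)) g ⟩
  ∑ (f ∘ (τ ⟨$⟩ʳ_)) + ∑ g        ≡⟨ cong (_+ ∑ g) (sum-permute f τ) ⟨
  ∑ f + ∑ g                      ≡⟨ ∑-distrib-+ f g ⟨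
  ∑ (λ j → f j + g j)            ∎

module _ (k : ℕ) .{{_ : NonZero k}} where

  private
    [m+n%k]%k≡[m+n]%k : ∀ m n → (m + n % k) % k ≡ (m + n) % k
    [m+n%k]%k≡[m+n]%k m n = begin
      (m + n % k) % k            ≡⟨ %-distribˡ-+ m (n % k) k ⟩
      (m % k + n % k % k) % k    ≡⟨ cong (λ z → (m % k + z) % k) (m%n%n≡m%n n k) ⟩
      (m % k + n % k) % k        ≡⟨ %-distribˡ-+ m n k ⟨
      (m + n) % k                ∎

    suc[i+[k∸1]]≡i+k : ∀ i → suc (i + (k ∸ 1)) ≡ i + k
    suc[i+[k∸1]]≡i+k i = trans (sym (+-suc i (k ∸ 1))) (cong (i +_) (m+[n∸m]≡n (>-nonZero⁻¹ k)))

    [i+k]%k≡i : ∀ (i : Fin k) → (toℕ i + k) % k ≡ toℕ i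
    [i+k]%k≡i i = trans ([m+n]%n≡m%n (toℕ i) k) (m<n⇒m%n≡m (toℕ<n i))

  nextIdx-prevIdx : ∀ i → nextIdx k (prevIdx k i) ≡ i
  nextIdx-prevIdx i = toℕ-injective (begin
    toℕ (nextIdx k (prevIdx k i))         ≡⟨ toℕ-fromℕ< _ ⟩
    suc (toℕ (prevIdx k i)) % k           ≡⟨ cong (λ z → suc z % k) (toℕ-fromℕ< _) ⟩
    (1 + (toℕ i + (k ∸ 1)) % k) % k       ≡⟨ [m+n%k]%k≡[m+n]%k 1 (toℕ i + (k ∸ 1)) ⟩
    suc (toℕ i + (k ∸ 1)) % k             ≡⟨ cong (_% k) (suc[i+[k∸1]]≡i+k (toℕ i)) ⟩
    (toℕ i + k) % k                       ≡⟨ [i+k]%k≡i i ⟩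
    toℕ i                                 ∎)

  prevIdx-nextIdx : ∀ i → prevIdx k (nextIdx k i) ≡ i
  prevIdx-nextIdx i = toℕ-injective (begin
    toℕ (prevIdx k (nextIdx k i))         ≡⟨ toℕ-fromℕ< _ ⟩
    (toℕ (nextIdx k i) + (k ∸ 1)) % k     ≡⟨ cong (λ z → (z + (k ∸ 1)) % k) (toℕ-fromℕ< _) ⟩
    (suc (toℕ i) % k + (k ∸ 1)) % k       ≡⟨ cong (_% k) (+-comm (suc (toℕ i) % k) (k ∸ 1)) ⟩
    ((k ∸ 1) + suc (toℕ i) % k) % k       ≡⟨ [m+n%k]%k≡[m+n]%k (k ∸ 1) (suc (toℕ i)) ⟩
    ((k ∸ 1) + suc (toℕ i)) % k           ≡⟨ cong (_% k) (+-comm (k ∸ 1) (suc (toℕ i))) ⟩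
    suc (toℕ i + (k ∸ 1)) % k             ≡⟨ cong (_% k) (suc[i+[k∸1]]≡i+k (toℕ i)) ⟩
    (toℕ i + k) % k                       ≡⟨ [i+k]%k≡i i ⟩
    toℕ i                                 ∎)

  clockwiseShift : Permutation′ k
  clockwiseShift = permutation (nextIdx k) (prevIdx k) nextIdx-prevIdx prevIdx-nextIdx

-- Turns along a permutation of the seats

-- Seat j passes lookup a j marbles to seat π ⟨$⟩ʳ j; step k clockwise is, definitionally,
-- pass (clockwiseShift k) and step k counterclockwise is pass (flip (clockwiseShift k)).
pass : Permutation′ k → Arrangement k → Turn k → Arrangement k
pass π m a = tabulate λ j → lookup m j ∸ lookup a j + lookup a (π ⟨$⟩ˡ j)

undo : Permutation′ k → Turn k → Turn k
undo π a = tabulate λ j → lookup a (π ⟨$⟩ˡ j)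

shared : Permutation′ k → Turn k → Turn k → Fin k → ℕ
shared π a b j = lookup a j ⊓ lookup b (π ⟨$⟩ʳ j)

-- Trades a turn a along π followed by a turn b along flip π for turns b′ along flip π
-- and then a′ along π with the same outcome; the ⊓-terms make the same formula, read
-- along flip π, the inverse trade.
exchange : Permutation′ k → Turn k × Turn k → Turn k × Turn k
exchange π (a , b) =
  (tabulate λ j → shared π a b j + (lookup b j ∸ lookup a (π ⟨$⟩ˡ j))) ,
  (tabulate λ j → shared π a b (π ⟨$⟩ʳ j) + (lookup a j ∸ lookup b (π ⟨$⟩ʳ j)))

module _ (π : Permutation′ k) where

  lookup-pass : ∀ m a j → lookup (pass π m a) j ≡ lookup m j ∸ lookup a j + lookup a (π ⟨$⟩ˡ j)
  lookup-pass m a j = lookup∘tabulate _ j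

  lookup-undo : ∀ a j → lookup (undo π a) j ≡ lookup a (π ⟨$⟩ˡ j)
  lookup-undo a j = lookup∘tabulate _ j

  lookup-undo-ʳ : ∀ a j → lookup (undo π a) (π ⟨$⟩ʳ j) ≡ lookup a j
  lookup-undo-ʳ a j = trans (lookup-undo a (π ⟨$⟩ʳ j)) (cong (lookup a) (inverseˡ π))

  shared-ˡ : ∀ a b j → shared π a b (π ⟨$⟩ˡ j) ≡ lookup b j ⊓ lookup a (π ⟨$⟩ˡ j)
  shared-ˡ a b j = trans (cong (λ i → lookup a (π ⟨$⟩ˡ j) ⊓ lookup b i) (inverseʳ π)) (⊓-comm _ _)

  module _ (a b : Turn k) (j : Fin k) where

    lookup-exchange₁ : lookup (proj₁ (exchange π (a , b))) j
                       ≡ shared π a b j + (lookup b j ∸ lookup a (π ⟨$⟩ˡ j))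
    lookup-exchange₁ = lookup∘tabulate _ j

    lookup-exchange₁-ʳ : lookup (proj₁ (exchange π (a , b))) (π ⟨$⟩ʳ j)
                       ≡ shared π a b (π ⟨$⟩ʳ j) + (lookup b (π ⟨$⟩ʳ j) ∸ lookup a j)
    lookup-exchange₁-ʳ = trans (lookup∘tabulate _ (π ⟨$⟩ʳ j))
      (cong (λ i → shared π a b (π ⟨$⟩ʳ j) + (lookup b (π ⟨$⟩ʳ j) ∸ lookup a i)) (inverseˡ π))

    lookup-exchange₂ : lookup (proj₂ (exchange π (a , b))) j
                       ≡ shared π a b (π ⟨$⟩ʳ j) + (lookup a j ∸ lookup b (π ⟨$⟩ʳ j))
    lookup-exchange₂ = lookup∘tabulate _ j

    lookup-exchange₂-ˡ : lookup (proj₂ (exchange π (a , b))) (π ⟨$⟩ˡ j)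
                       ≡ shared π a b j + (lookup a (π ⟨$⟩ˡ j) ∸ lookup b j)
    lookup-exchange₂-ˡ = trans (lookup∘tabulate _ (π ⟨$⟩ˡ j))
      (cong (λ i → shared π a b i + (lookup a (π ⟨$⟩ˡ j) ∸ lookup b i)) (inverseʳ π))

module _ (π : Permutation′ k) where

  sum-pass : ∀ {m a} → Pointwise _≤_ a m → sum (pass π m a) ≡ sum m
  sum-pass {m} {a} a≤m = begin
    sum (pass π m a)
      ≡⟨ sum-tabulate {k} _ ⟩
    ∑ (λ j → lookup m j ∸ lookup a j + lookup a (π ⟨$⟩ˡ j))
      ≡⟨ sum-cong-≗ (λ j → +-comm (lookup m j ∸ lookup a j) _) ⟩
    ∑ (λ j → lookup a (π ⟨$⟩ˡ j) + (lookup m j ∸ lookup a j))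
      ≡⟨ ∑-permute-+ˡ (flip π) (lookup a) _ ⟩
    ∑ (λ j → lookup a j + (lookup m j ∸ lookup a j))
      ≡⟨ sum-cong-≗ (λ j → m+[n∸m]≡n (Pointwise.lookup a≤m j)) ⟩
    ∑ (lookup m)
      ≡⟨ sum≡∑-lookup m ⟨
    sum m ∎

  undo-≤-pass : ∀ m a → Pointwise _≤_ (undo π a) (pass π m a)
  undo-≤-pass m a = tabulate⁺ λ j → m≤n+m (lookup a (π ⟨$⟩ˡ j)) (lookup m j ∸ lookup a j)

  pass-undo : ∀ {m a} → Pointwise _≤_ a m → pass (flip π) (pass π m a) (undo π a) ≡ m
  pass-undo {m} {a} a≤m = tabulate≡ λ j → begin
    lookup (pass π m a) j ∸ lookup (undo π a) j + lookup (undo π a) (π ⟨$⟩ʳ j)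
      ≡⟨ cong₂ (λ u v → u ∸ v + lookup (undo π a) (π ⟨$⟩ʳ j)) (lookup-pass π m a j) (lookup-undo π a j) ⟩
    lookup m j ∸ lookup a j + lookup a (π ⟨$⟩ˡ j) ∸ lookup a (π ⟨$⟩ˡ j) + lookup (undo π a) (π ⟨$⟩ʳ j)
      ≡⟨ cong₂ _+_ (m+n∸n≡m (lookup m j ∸ lookup a j) (lookup a (π ⟨$⟩ˡ j))) (lookup-undo-ʳ π a j) ⟩
    lookup m j ∸ lookup a j + lookup a j
      ≡⟨ m∸n+n≡m (Pointwise.lookup a≤m j) ⟩
    lookup m j ∎

  undo-involutive : ∀ a → undo (flip π) (undo π a) ≡ a
  undo-involutive a = tabulate≡ (lookup-undo-ʳ π a)

  sum-undo : ∀ a → sum (undo π a) ≡ sum a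
  sum-undo a = begin
    sum (undo π a)                 ≡⟨ sum-tabulate {k} _ ⟩
    ∑ (lookup a ∘ (π ⟨$⟩ˡ_))       ≡⟨ sum-permute (lookup a) (flip π) ⟨
    ∑ (lookup a)                   ≡⟨ sum≡∑-lookup a ⟨
    sum a                          ∎

  shared-exchange : ∀ a b j → let (b′ , a′) = exchange π (a , b) in shared (flip π) b′ a′ j ≡ shared π a b j
  shared-exchange a b j =
    trans (cong₂ _⊓_ (lookup-exchange₁ π a b j) (lookup-exchange₂-ˡ π a b j))
          ([o+m∸n]⊓[o+n∸m]≡o (shared π a b j) (lookup b j) (lookup a (π ⟨$⟩ˡ j)))

  exchange-involutive : ∀ a b → exchange (flip π) (exchange π (a , b)) ≡ (a , b)
  exchange-involutive a b = cong₂ _,_ (tabulate≡ first) (tabulate≡ second)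
    where
    b′ a′ : Turn k
    b′ = proj₁ (exchange π (a , b))
    a′ = proj₂ (exchange π (a , b))
    first : ∀ j → shared (flip π) b′ a′ j + (lookup a′ j ∸ lookup b′ (π ⟨$⟩ʳ j)) ≡ lookup a j
    first j = begin
      shared (flip π) b′ a′ j + (lookup a′ j ∸ lookup b′ (π ⟨$⟩ʳ j))
        ≡⟨ cong₂ _+_ (shared-exchange a b j)
                  (cong₂ _∸_ (lookup-exchange₂ π a b j) (lookup-exchange₁-ʳ π a b j)) ⟩
      shared π a b j + (shared π a b (π ⟨$⟩ʳ j) + (lookup a j ∸ lookup b (π ⟨$⟩ʳ j))
                         ∸ (shared π a b (π ⟨$⟩ʳ j) + (lookup b (π ⟨$⟩ʳ j) ∸ lookup a j)))
        ≡⟨ m⊓n+[[o+m∸n]∸[o+n∸m]]≡m (shared π a b (π ⟨$⟩ʳ j)) (lookup a j) (lookup b (π ⟨$⟩ʳ j)) ⟩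
      lookup a j ∎
    second : ∀ j → shared (flip π) b′ a′ (π ⟨$⟩ˡ j) + (lookup b′ j ∸ lookup a′ (π ⟨$⟩ˡ j)) ≡ lookup b j
    second j = begin
      shared (flip π) b′ a′ (π ⟨$⟩ˡ j) + (lookup b′ j ∸ lookup a′ (π ⟨$⟩ˡ j))
        ≡⟨ cong₂ _+_ (trans (shared-exchange a b (π ⟨$⟩ˡ j)) (shared-ˡ π a b j))
                  (cong₂ _∸_ (lookup-exchange₁ π a b j) (lookup-exchange₂-ˡ π a b j)) ⟩
      lookup b j ⊓ lookup a (π ⟨$⟩ˡ j) + (shared π a b j + (lookup b j ∸ lookup a (π ⟨$⟩ˡ j))
                                           ∸ (shared π a b j + (lookup a (π ⟨$⟩ˡ j) ∸ lookup b j)))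
        ≡⟨ m⊓n+[[o+m∸n]∸[o+n∸m]]≡m (shared π a b j) (lookup b j) (lookup a (π ⟨$⟩ˡ j)) ⟩
      lookup b j ∎

  sum-exchange₁ : ∀ a b → sum (proj₁ (exchange π (a , b))) ≡ sum b
  sum-exchange₁ a b = begin
    sum (proj₁ (exchange π (a , b)))
      ≡⟨ sum-tabulate {k} _ ⟩
    ∑ (λ j → shared π a b j + (lookup b j ∸ lookup a (π ⟨$⟩ˡ j)))
      ≡⟨ ∑-permute-+ˡ (flip π) (shared π a b) _ ⟨
    ∑ (λ j → shared π a b (π ⟨$⟩ˡ j) + (lookup b j ∸ lookup a (π ⟨$⟩ˡ j)))
      ≡⟨ sum-cong-≗ (λ j → trans (cong (_+ (lookup b j ∸ lookup a (π ⟨$⟩ˡ j))) (shared-ˡ π a b j))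
                                 (m⊓n+m∸n≡m (lookup b j) (lookup a (π ⟨$⟩ˡ j)))) ⟩
    ∑ (lookup b)
      ≡⟨ sum≡∑-lookup b ⟨
    sum b ∎

  module _ {m a b : Vec ℕ k} (a≤m : Pointwise _≤_ a m) (b≤ : Pointwise _≤_ b (pass π m a)) where

    private
      b′ a′ : Turn k
      b′ = proj₁ (exchange π (a , b))
      a′ = proj₂ (exchange π (a , b))

      b≤ʲ : ∀ j → lookup b j ≤ lookup m j ∸ lookup a j + lookup a (π ⟨$⟩ˡ j)
      b≤ʲ j = subst (lookup b j ≤_) (lookup-pass π m a j) (Pointwise.lookup b≤ j)

      lookup-pass-b′ : ∀ j → lookup (pass (flip π) m b′) j
                           ≡ lookup m j ∸ (shared π a b j + (lookup b j ∸ lookup a (π ⟨$⟩ˡ j)))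
                               + (shared π a b (π ⟨$⟩ʳ j) + (lookup b (π ⟨$⟩ʳ j) ∸ lookup a j))
      lookup-pass-b′ j = trans (lookup-pass (flip π) m b′ j)
        (cong₂ (λ u v → lookup m j ∸ u + v) (lookup-exchange₁ π a b j) (lookup-exchange₁-ʳ π a b j))

    exchange-valid : let (b′ , a′) = exchange π (a , b) in
                     Pointwise _≤_ b′ m × Pointwise _≤_ a′ (pass (flip π) m b′)
    exchange-valid =
      pointwise (λ j → subst (_≤ lookup m j) (sym (lookup-exchange₁ π a b j))
                              (exchange-seat-≤ˡ (Pointwise.lookup a≤m j) (b≤ʲ j))) ,
      pointwise (λ j → subst₂ _≤_ (sym (lookup-exchange₂ π a b j)) (sym (lookup-pass-b′ j))
                               (exchange-seat-≤ʳ (Pointwise.lookup a≤m j) (b≤ʲ j) (shared π a b (π ⟨$⟩ʳ j))))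

    exchange-pass : let (b′ , a′) = exchange π (a , b) in
                    pass π (pass (flip π) m b′) a′ ≡ pass (flip π) (pass π m a) b
    exchange-pass = tabulate-cong λ j → begin
      lookup (pass (flip π) m b′) j ∸ lookup a′ j + lookup a′ (π ⟨$⟩ˡ j)
        ≡⟨ cong₂ _+_ (cong₂ _∸_ (lookup-pass-b′ j) (lookup-exchange₂ π a b j)) (lookup-exchange₂-ˡ π a b j) ⟩
      lookup m j ∸ (shared π a b j + (lookup b j ∸ lookup a (π ⟨$⟩ˡ j)))
        + (shared π a b (π ⟨$⟩ʳ j) + (lookup b (π ⟨$⟩ʳ j) ∸ lookup a j))
        ∸ (shared π a b (π ⟨$⟩ʳ j) + (lookup a j ∸ lookup b (π ⟨$⟩ʳ j)))
        + (shared π a b j + (lookup a (π ⟨$⟩ˡ j) ∸ lookup b j))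
        ≡⟨ exchange-seat-≡ (Pointwise.lookup a≤m j) (b≤ʲ j) (shared π a b (π ⟨$⟩ʳ j)) ⟩
      lookup m j ∸ lookup a j + lookup a (π ⟨$⟩ˡ j) ∸ lookup b j + lookup b (π ⟨$⟩ʳ j)
        ≡⟨ cong (λ u → u ∸ lookup b j + lookup b (π ⟨$⟩ʳ j)) (lookup-pass π m a j) ⟨
      lookup (pass π m a) j ∸ lookup b j + lookup b (π ⟨$⟩ʳ j) ∎

sum-exchange₂ : ∀ {k} (π : Permutation′ k) a b → sum (proj₂ (exchange π (a , b))) ≡ sum a
sum-exchange₂ {k} π a b = begin
  sum (proj₂ (exchange π (a , b)))                              ≡⟨ sum-exchange₁ (flip π) b′ a′ ⟨
  sum (proj₁ (exchange (flip π) (exchange π (a , b))))          ≡⟨ cong (sum ∘ proj₁) (exchange-involutive π a b) ⟩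
  sum a                                                         ∎
  where
  b′ a′ : Turn k
  b′ = proj₁ (exchange π (a , b))
  a′ = proj₂ (exchange π (a , b))

-- Walks

_⨾_ : ∀ {X : Set} → (X → X → Set) → (X → X → Set) → X → X → Set
(R ⨾ S) x z = Σ _ λ y → R x y × S y z

module Walks {X D : Set} (Step : D → X → X → Set) where

  Walk : ∀ {t} → Vec D t → X → X → Set
  Walk []       x z = x ≡ z
  Walk (d ∷ ds) x z = Σ X λ y → Step d x y × Walk ds y z

  WalksFrom : ∀ {t} → Vec D t → X → Set
  WalksFrom ds x = Σ X (Walk ds x)

  WalksFrom-∷ : ∀ {t d} {ds : Vec D t} {x} → WalksFrom (d ∷ ds) x ↔ (Σ X λ y → Step d x y × WalksFrom ds y)
  WalksFrom-∷ = mk↔ₛ′ (λ (z , y , s , w) → y , s , z , w) (λ (y , s , z , w) → z , y , s , w)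
    (λ _ → refl) (λ _ → refl)

  WalksFrom-∷∷ : ∀ {t d e} {ds : Vec D t} {x} →
                 WalksFrom (d ∷ e ∷ ds) x ↔ (Σ X λ w → (Step d ⨾ Step e) x w × WalksFrom ds w)
  WalksFrom-∷∷ = mk↔ₛ′ (λ (z , y , s , w , r , p) → w , (y , s , r) , z , p)
    (λ (w , (y , s , r) , z , p) → z , y , s , w , r , p) (λ _ → refl) (λ _ → refl)

  WalksFrom-[_] : ∀ d {x} → WalksFrom (d ∷ []) x ↔ Σ X (Step d x)
  WalksFrom-[ d ] = mk↔ₛ′ (λ (z , y , s , _) → y , s) (λ (y , s) → y , y , s , refl)
    (λ _ → refl) (λ { (z , y , s , refl) → refl })

  WalksFrom-∷-cong : ∀ {t d} {ds ds′ : Vec D t} → (∀ y → WalksFrom ds y ↔ WalksFrom ds′ y) →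
                     ∀ x → WalksFrom (d ∷ ds) x ↔ WalksFrom (d ∷ ds′) x
  WalksFrom-∷-cong ds↔ds′ x =
    ↔-trans WalksFrom-∷ (↔-trans (congˡ (↔-refl ×-↔ ds↔ds′ _)) (↔-sym WalksFrom-∷))

  WalksFrom-wordIndependent :
    (∀ d e {x z} → (Step d ⨾ Step e) x z ↔ (Step e ⨾ Step d) x z) →
    (∀ d e x → Σ X (Step d x) ↔ Σ X (Step e x)) →
    ∀ {t} (ds ds′ : Vec D t) x → WalksFrom ds x ↔ WalksFrom ds′ x
  WalksFrom-wordIndependent commute outDegree = go
    where
    go : ∀ {t} (ds ds′ : Vec D t) x → WalksFrom ds x ↔ WalksFrom ds′ x
    go []           []       x = ↔-refl
    go (d ∷ [])     (e ∷ []) x = ↔-trans WalksFrom-[ d ] (↔-trans (outDegree d e x) (↔-sym WalksFrom-[ e ]))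
    -- make e the second letter, then commute it to the front
    go (d ∷ d₁ ∷ ds) (e ∷ ds′) x =
      ↔-trans (WalksFrom-∷-cong (go (d₁ ∷ ds) (e ∷ ds)) x)
     (↔-trans (↔-trans WalksFrom-∷∷ (↔-trans (congˡ (commute d e ×-↔ ↔-refl)) (↔-sym WalksFrom-∷∷)))
              (WalksFrom-∷-cong (go (d ∷ ds) ds′) x))

  Walk-invariant : ∀ {A : Set} (f : X → A) → (∀ {d x y} → Step d x y → f x ≡ f y) →
                   ∀ {t} {ds : Vec D t} {x y} → Walk ds x y → f x ≡ f y
  Walk-invariant f step-inv {ds = []}     refl          = refl
  Walk-invariant f step-inv {ds = d ∷ ds} (y , s , w)  = trans (step-inv s) (Walk-invariant f step-inv w)

  Walk-snoc : ∀ t {d x z} → Walk (replicate (suc t) d) x z ↔ (Σ X λ y → Walk (replicate t d) x y × Step d y z)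
  Walk-snoc zero = mk↔ₛ′ (λ { (y , s , refl) → _ , refl , s }) (λ { (y , refl , s) → _ , s , refl })
    (λ { (y , refl , s) → refl }) (λ { (y , s , refl) → refl })
  Walk-snoc (suc t) {d} {x} {z} = mk↔ₛ′ to from to∘from from∘to
    where
    module IH {y} = Inverse (Walk-snoc t {d} {y} {z})
    to : Walk (replicate (suc (suc t)) d) x z → Σ X λ w → Walk (replicate (suc t) d) x w × Step d w z
    to (y , s , p) = let (w , q , r) = IH.to p in w , (y , s , q) , r
    from : (Σ X λ w → Walk (replicate (suc t) d) x w × Step d w z) → Walk (replicate (suc (suc t)) d) x z
    from (w , (y , s , q) , r) = y , s , IH.from (w , q , r)
    to∘from : ∀ p → to (from p) ≡ p
    to∘from (w , (y , s , q) , r) =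
      cong (λ (w , q , r) → w , (y , s , q) , r) (IH.strictlyInverseˡ (w , q , r))
    from∘to : ∀ p → from (to p) ≡ p
    from∘to (y , s , p) = cong (λ p → y , s , p) (IH.strictlyInverseʳ p)

  Walk-reverse : ∀ {d e} → (∀ {x y} → Step d x y ↔ Step e y x) →
                 ∀ t {x y} → Walk (replicate t d) x y ↔ Walk (replicate t e) y x
  Walk-reverse reverse zero = mk↔ₛ′ sym sym (λ { refl → refl }) (λ { refl → refl })
  Walk-reverse reverse (suc t) =
    ↔-trans (Walk-snoc t) (congˡ (↔-trans (Walk-reverse reverse t ×-↔ reverse) (×-comm _ _)))

-- Marble games

Pointwise-≤-irrelevant : ∀ {n} {u v : Vec ℕ n} (p q : Pointwise _≤_ u v) → p ≡ q
Pointwise-≤-irrelevant []       []       = refl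
Pointwise-≤-irrelevant (p ∷ ps) (q ∷ qs) = cong₂ _∷_ (≤-irrelevant p q) (Pointwise-≤-irrelevant ps qs)

TurnOK-irrelevant : ∀ {k} b {a : Turn k} (p q : TurnOK b a) → p ≡ q
TurnOK-irrelevant false p q = refl
TurnOK-irrelevant true  p q = ≡-irrelevant p q

TurnOK-resp-sum : ∀ {k} b {a a′ : Turn k} → sum a ≡ sum a′ → TurnOK b a → TurnOK b a′
TurnOK-resp-sum false _ _  = tt
TurnOK-resp-sum true  e ok = trans (sym e) ok

Σ-fibres : ∀ {A B : Set} {P : A → Set} (f : A → B) → Σ A P ↔ (Σ B λ y → Σ A λ a → P a × f a ≡ y)
Σ-fibres f = mk↔ₛ′ (λ (a , p) → f a , a , p , refl) (λ (_ , a , p , _) → a , p)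
  (λ { (_ , a , p , refl) → refl }) (λ _ → refl)

×-absorb-irrelevantˡ : ∀ {P Q : Set} → (∀ (p q : P) → p ≡ q) → (Q → P) → (P × Q) ↔ Q
×-absorb-irrelevantˡ P-irr Q⇒P = mk↔ₛ′ proj₂ (λ q → Q⇒P q , q) (λ _ → refl)
  (λ (p , q) → cong (_, q) (P-irr _ p))

module Game (k : ℕ) .{{_ : NonZero k}} (oneMarble : Bool) where

  Valid : Arrangement k → Turn k → Set
  Valid m a = Pointwise _≤_ a m × TurnOK oneMarble a

  Valid-irrelevant : ∀ {m a} (u v : Valid m a) → u ≡ v
  Valid-irrelevant (p , o) (q , o′) = cong₂ _,_ (Pointwise-≤-irrelevant p q) (TurnOK-irrelevant oneMarble o o′)

  StepAlong : Permutation′ k → Arrangement k → Arrangement k → Set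
  StepAlong π x y = Σ (Turn k) λ a → Valid x a × pass π x a ≡ y

  StepAlong-≡ : ∀ {π x y} {s s′ : StepAlong π x y} → proj₁ s ≡ proj₁ s′ → s ≡ s′
  StepAlong-≡ {s = a , v , e} {.a , v′ , e′} refl =
    cong₂ (λ v e → a , v , e) (Valid-irrelevant v v′) (Decidable⇒UIP.≡-irrelevant (≡-dec _≟_) e e′)

  turns : ∀ {π π′ x z} → (StepAlong π ⨾ StepAlong π′) x z → Turn k × Turn k
  turns (_ , (a , _) , (b , _)) = a , b

  StepAlong-⨾-≡ : ∀ {π π′ x z} {s s′ : (StepAlong π ⨾ StepAlong π′) x z} →
                  turns {π} {π′} s ≡ turns {π} {π′} s′ → s ≡ s′
  StepAlong-⨾-≡ {π′ = π′} {s = _ , (a , v , refl) , r} {_ , (.a , v′ , refl) , r′} refl =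
    cong₂ (λ v r → _ , (a , v , refl) , r) (Valid-irrelevant v v′) (StepAlong-≡ {π = π′} refl)

  StepAlong-sum : ∀ {π x y} → StepAlong π x y → sum x ≡ sum y
  StepAlong-sum {π} (a , (a≤x , _) , e) = trans (sym (sum-pass π a≤x)) (cong sum e)

  undoStep : ∀ π {x y} → StepAlong π x y → StepAlong (flip π) y x
  undoStep π {x} (a , (a≤x , ok) , e) =
    undo π a ,
    (subst (Pointwise _≤_ (undo π a)) e (undo-≤-pass π x a) , TurnOK-resp-sum oneMarble (sym (sum-undo π a)) ok) ,
    trans (cong (λ y → pass (flip π) y (undo π a)) (sym e)) (pass-undo π a≤x)

  undoStep-involutive : ∀ π {x y} (s : StepAlong π x y) → undoStep (flip π) (undoStep π s) ≡ s
  undoStep-involutive π (a , _) = StepAlong-≡ {π = π} (undo-involutive π a)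

  StepAlong-reverse : ∀ π {x y} → StepAlong π x y ↔ StepAlong (flip π) y x
  StepAlong-reverse π = mk↔ₛ′ (undoStep π) (undoStep (flip π))
    (undoStep-involutive (flip π)) (undoStep-involutive π)

  exchangeSteps : ∀ π {x z} → (StepAlong π ⨾ StepAlong (flip π)) x z → (StepAlong (flip π) ⨾ StepAlong π) x z
  exchangeSteps π {x} (_ , (a , (a≤x , oka) , refl) , (b , (b≤ , okb) , e)) =
    let (b′ , a′) = exchange π (a , b)
        (b′≤x , a′≤) = exchange-valid π a≤x b≤
    in pass (flip π) x b′ ,
       (b′ , (b′≤x , TurnOK-resp-sum oneMarble (sym (sum-exchange₁ π a b)) okb) , refl) ,
       (a′ , (a′≤ , TurnOK-resp-sum oneMarble (sym (sum-exchange₂ π a b)) oka) , trans (exchange-pass π a≤x b≤) e)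

  exchangeSteps-involutive : ∀ π {x z} (s : (StepAlong π ⨾ StepAlong (flip π)) x z) →
                             exchangeSteps (flip π) (exchangeSteps π s) ≡ s
  exchangeSteps-involutive π (_ , (a , _ , refl) , (b , _ , _)) =
    StepAlong-⨾-≡ {π = π} {π′ = flip π} (exchange-involutive π a b)

  StepAlong-exchange : ∀ π {x z} → (StepAlong π ⨾ StepAlong (flip π)) x z ↔ (StepAlong (flip π) ⨾ StepAlong π) x z
  StepAlong-exchange π = mk↔ₛ′ (exchangeSteps π) (exchangeSteps (flip π))
    (exchangeSteps-involutive (flip π)) (exchangeSteps-involutive π)

  Step : Direction → Arrangement k → Arrangement k → Set
  Step d x y = Σ (Turn k) λ a → Valid x a × step k d x a ≡ y

  Step-commute : ∀ d e {x z} → (Step d ⨾ Step e) x z ↔ (Step e ⨾ Step d) x z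
  Step-commute clockwise        clockwise        = ↔-refl
  Step-commute clockwise        counterclockwise = StepAlong-exchange (clockwiseShift k)
  Step-commute counterclockwise clockwise        = StepAlong-exchange (flip (clockwiseShift k))
  Step-commute counterclockwise counterclockwise = ↔-refl

  Step-outDegree : ∀ d x → Σ _ (Step d x) ↔ Σ (Turn k) (Valid x)
  Step-outDegree d x = mk↔ₛ′ (λ (_ , a , v , _) → a , v) (λ (a , v) → step k d x a , a , v , refl)
    (λ _ → refl) (λ { (_ , a , v , refl) → refl })

  Step-sum : ∀ {d x y} → Step d x y → sum x ≡ sum y
  Step-sum {clockwise}        = StepAlong-sum {clockwiseShift k}
  Step-sum {counterclockwise} = StepAlong-sum {flip (clockwiseShift k)}

  open Walks Step

  turnSequences-walks : ∀ d t {x y} →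
    (Σ (Vec (Turn k) t) λ ts → ValidTurns k d oneMarble x ts × final k d x ts ≡ y) ↔ Walk (replicate t d) x y
  turnSequences-walks d zero =
    mk↔ₛ′ (λ { ([] , _ , e) → e }) (λ e → [] , tt , e) (λ _ → refl) (λ { ([] , tt , e) → refl })
  turnSequences-walks d (suc t) {x} {z} = mk↔ₛ′ to from to∘from from∘to
    where
    module IH {y} = Inverse (turnSequences-walks d t {y} {z})
    to : _ → Walk (replicate (suc t) d) x z
    to (a ∷ ts , (a≤x , ok , vs) , e) = step k d x a , (a , (a≤x , ok) , refl) , IH.to (ts , vs , e)
    from : Walk (replicate (suc t) d) x z → _
    from (_ , (a , (a≤x , ok) , refl) , w) =
      let (ts , vs , e) = IH.from w in a ∷ ts , (a≤x , ok , vs) , e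
    to∘from : ∀ w → to (from w) ≡ w
    to∘from (_ , (a , v , refl) , w) = cong (λ w → _ , (a , v , refl) , w) (IH.strictlyInverseˡ w)
    from∘to : ∀ g → from (to g) ≡ g
    from∘to (a ∷ ts , (a≤x , ok , vs) , e) =
      cong (λ (ts , vs , e) → a ∷ ts , (a≤x , ok , vs) , e) (IH.strictlyInverseʳ (ts , vs , e))

  gamesStartingAt-walks : ∀ d t x → GamesStartingAt k d oneMarble t x ↔ WalksFrom (replicate t d) x
  gamesStartingAt-walks d t x =
    ↔-trans (Σ-fibres (final k d x)) (congˡ (turnSequences-walks d t))

  gamesEndingAt-walks : ∀ n d t y →
    GamesEndingAt k n d oneMarble t y ↔ (Σ _ λ x → sum x ≡ n ∸ k × Walk (replicate t d) x y)
  gamesEndingAt-walks n d t y = congˡ (↔-refl ×-↔ turnSequences-walks d t)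

  -- Turns preserve the number of marbles, so the condition on the initial arrangement is automatic.
  gamesEndingAt↔gamesStartingAt : ∀ n t y → sum y ≡ n ∸ k →
    GamesEndingAt k n clockwise oneMarble t y ↔ GamesStartingAt k counterclockwise oneMarble t y
  gamesEndingAt↔gamesStartingAt n t y sum-y =
    ↔-trans (gamesEndingAt-walks n clockwise t y)
   (↔-trans (congˡ (×-absorb-irrelevantˡ ≡-irrelevant λ w →
                      trans (Walk-invariant sum (λ {d} → Step-sum {d}) w) sum-y))
   (↔-trans (congˡ (Walk-reverse (StepAlong-reverse (clockwiseShift k)) t))
            (↔-sym (gamesStartingAt-walks counterclockwise t y))))

  gamesStartingAt-directionIndependent : ∀ t x →
    GamesStartingAt k clockwise oneMarble t x ↔ GamesStartingAt k counterclockwise oneMarble t x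
  gamesStartingAt-directionIndependent t x =
    ↔-trans (gamesStartingAt-walks clockwise t x)
   (↔-trans (WalksFrom-wordIndependent Step-commute
              (λ d e x → ↔-trans (Step-outDegree d x) (↔-sym (Step-outDegree e x)))
              (replicate t clockwise) (replicate t counterclockwise) x)
            (↔-sym (gamesStartingAt-walks counterclockwise t x)))

-- The marbles of Arr α

module _ where

  open import Data.Integer using (+_; _-_)

  module _ (α : ℤ → ℤ) (antitone : ∀ i j → i ℤ.≤ j → α j ℤ.≤ α i) where

    gap : ℕ → ℕ
    gap s = ∣ α (+ s - + 1) - α (+ s) ∣

    +gap : ∀ s → + gap s ≡ α (+ s - + 1) - α (+ s)
    +gap s = 0≤i⇒+∣i∣≡i (i≤j⇒0≤j-i (antitone _ _ (i-j≤i (+ s) (+ 1))))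

    sum-gaps : ∀ j s → + sum (tabulate {n = j} λ i → gap (s ℕ.+ toℕ i)) ≡ α (+ s - + 1) - α (+ (s ℕ.+ j) - + 1)
    sum-gaps zero s = begin
      + 0                                   ≡⟨ +-inverseʳ (α (+ s - + 1)) ⟨
      α (+ s - + 1) - α (+ s - + 1)         ≡⟨ cong (λ u → α (+ s - + 1) - α (+ u - + 1)) (+-identityʳ s) ⟨
      α (+ s - + 1) - α (+ (s ℕ.+ 0) - + 1) ∎
    sum-gaps (suc j) s = begin
      + (gap (s ℕ.+ 0) ℕ.+ sum (tabulate {n = j} λ i → gap (s ℕ.+ suc (toℕ i))))
        ≡⟨ pos-+ (gap (s ℕ.+ 0)) _ ⟩
      + gap (s ℕ.+ 0) ℤ.+ + sum (tabulate {n = j} λ i → gap (s ℕ.+ suc (toℕ i)))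
        ≡⟨ cong₂ ℤ._+_ (trans (cong (+_ ∘′ gap) (+-identityʳ s)) (+gap s))
                        (trans (cong (+_ ∘′ sum) (tabulate-cong {n = j} λ i → cong gap (+-suc s (toℕ i))))
                               (sum-gaps j (suc s))) ⟩
      (α (+ s - + 1) - α (+ s)) ℤ.+ (α (+ suc s - + 1) - α (+ (suc s ℕ.+ j) - + 1))
        ≡⟨ cong₂ (λ u v → (α (+ s - + 1) - α (+ s)) ℤ.+ (α u - α (+ v - + 1))) (+1+i-1≡i (+ s)) (sym (+-suc s j)) ⟩
      (α (+ s - + 1) - α (+ s)) ℤ.+ (α (+ s) - α (+ (s ℕ.+ suc j) - + 1))
        ≡⟨ telescope (α (+ s - + 1)) (α (+ s)) (α (+ (s ℕ.+ suc j) - + 1)) ⟩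
      α (+ s - + 1) - α (+ (s ℕ.+ suc j) - + 1) ∎
      where
      +1+i-1≡i : ∀ i → + 1 ℤ.+ i - + 1 ≡ i
      +1+i-1≡i = ℤ-Solver.solve-∀
      telescope : ∀ x y z → (x - y) ℤ.+ (y - z) ≡ x - z
      telescope = ℤ-Solver.solve-∀

  sum-Arr : ∀ {k n} (c : CylindricPartition k n) → sum (Arr c) ≡ n ∸ k
  sum-Arr {k} {n} c = +-injective (begin
    + sum (Arr c)                                     ≡⟨ sum-gaps (α c) (weakDec c) k 0 ⟩
    α c (+ 0 - + 1) - α c (+ k - + 1)                 ≡⟨ cong (_- α c (+ k - + 1)) (periodic c (+ 0 - + 1)) ⟩
    α c (+ 0 - + 1 ℤ.+ + k) ℤ.+ + (n ∸ k) - α c (+ k - + 1)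
                                                      ≡⟨ cong (λ i → α c i ℤ.+ + (n ∸ k) - α c (+ k - + 1)) (shift (+ k)) ⟩
    α c (+ k - + 1) ℤ.+ + (n ∸ k) - α c (+ k - + 1)   ≡⟨ cancel (α c (+ k - + 1)) (+ (n ∸ k)) ⟩
    + (n ∸ k)                                         ∎)
    where
    shift : ∀ x → + 0 - + 1 ℤ.+ x ≡ x - + 1
    shift = ℤ-Solver.solve-∀
    cancel : ∀ x y → x ℤ.+ y - x ≡ y
    cancel = ℤ-Solver.solve-∀

mainTheorem6 : (k n : ℕ) .{{_ : NonZero k}} → k < n →
    (c : CylindricPartition k n) (t : ℕ) (oneMarble : Bool) →
    (GamesStartingAt k clockwise oneMarble t (Arr c)
       ↔ GamesEndingAt k n clockwise oneMarble t (Arr c))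
    × (GamesStartingAt k clockwise oneMarble t (Arr c)
       ↔ GamesStartingAt k counterclockwise oneMarble t (Arr c))
mainTheorem6 k n _ c t oneMarble =
  ↔-trans clockwise↔counterclockwise (↔-sym (gamesEndingAt↔gamesStartingAt n t (Arr c) (sum-Arr c))) ,
  clockwise↔counterclockwise
  where
  open Game k oneMarble
  clockwise↔counterclockwise :
    GamesStartingAt k clockwise oneMarble t (Arr c) ↔ GamesStartingAt k counterclockwise oneMarble t (Arr c)
  clockwise↔counterclockwise = gamesStartingAt-directionIndependent t (Arr c)
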